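{- Let $\sigma$ and $\sigma'$ be maximal gapped repeats in a word $w$ such that $\sigma$ is covered by $\sigma'$. Then $p(\sigma)\ge p(\sigma')>p(\sigma)/2$.
   Context: $w$ has length $n$. For a factor $w[i..j]$ we write $\mathrm{beg}=i$ and $\mathrm{end}=j$; a factor $u$ is contained in a factor $v$ if $\mathrm{beg}(v)\le\mathrm{beg}(u)$ and $\mathrm{end}(u)\le\mathrm{end}(v)$. A repeat $\sigma$ is a pair $(u',u'')$ of nonempty factors equal as words, with $\mathrm{beg}(u')<\mathrm{beg}(u'')$. Its period is $p(\sigma)=\mathrm{beg}(u'')-\mathrm{beg}(u')$, and $\mathrm{fact}(\sigma)=w[\mathrm{beg}(u')..\mathrm{end}(u'')]$. It is maximal if two conditions hold: if $\mathrm{beg}(u')>1$ then $w[\mathrm{beg}(u')-1]\ne w[\mathrm{beg}(u'')-1]$, and if $\mathrm{end}(u'')<n$ then $w[\mathrm{end}(u')+1]\ne w[\mathrm{end}(u'')+1]$. It is gapped if $\mathrm{beg}(u'')>\mathrm{end}(u')+1$. A maximal repeat $\sigma$ is covered by a maximal repeat $\sigma'$ if $\mathrm{fact}(\sigma)$ is contained in $\mathrm{fact}(\sigma')$ and $p(\sigma')<p(\sigma)$. -}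

module Defs where

open import Data.Nat using (ℕ; zero; suc; _+_; _∸_; _≤_; _<_; _>_)
open import Data.Fin using (fromℕ<)
open import Data.Vec using (Vec; lookup)
open import Data.Product using (_×_)
open import Relation.Binary.PropositionalEquality using (_≡_; _≢_)

-- A word w of length n over alphabet A is a  Vec A n.  Positions are 1-based:
-- w[i] for 1 ≤ i ≤ n is the (i-1)-th vector entry.
letter : {A : Set} {n : ℕ} → Vec A n → (i : ℕ) → 1 ≤ i → i ≤ n → A
letter w (suc i) _ h = lookup w (fromℕ< h)

record Factor (n : ℕ) : Set where
  constructor fac
  field
    beg     : ℕ
    end     : ℕ
    1≤beg   : 1 ≤ beg
    beg≤end : beg ≤ end
    end≤n   : end ≤ n
open Factor public

len : {n : ℕ} → Factor n → ℕ
len u = suc (end u) ∸ beg u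

EqualWords : {A : Set} {n : ℕ} → Vec A n → Factor n → Factor n → Set
EqualWords {n = n} w u v =
  len u ≡ len v ×
  ((k : ℕ) → k < len u →
     (h₁ : 1 ≤ beg u + k) (h₂ : beg u + k ≤ n)
     (h₃ : 1 ≤ beg v + k) (h₄ : beg v + k ≤ n) →
     letter w (beg u + k) h₁ h₂ ≡ letter w (beg v + k) h₃ h₄)

record Repeat {A : Set} {n : ℕ} (w : Vec A n) : Set where
  constructor rep
  field
    u₁    : Factor n
    u₂    : Factor n
    equal : EqualWords w u₁ u₂
    order : beg u₁ < beg u₂
open Repeat public

period : {A : Set} {n : ℕ} {w : Vec A n} → Repeat w → ℕ
period σ = beg (u₂ σ) ∸ beg (u₁ σ)

factBeg factEnd : {A : Set} {n : ℕ} {w : Vec A n} → Repeat w → ℕ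
factBeg σ = beg (u₁ σ)
factEnd σ = end (u₂ σ)

-- The bound proofs for the positions are quantified over (they exist exactly
-- when the premise holds, and letters do not depend on them).
Maximal : {A : Set} {n : ℕ} {w : Vec A n} → Repeat w → Set
Maximal {n = n} {w = w} σ =
  (1 < beg (u₁ σ) →
     (h₁ : 1 ≤ beg (u₁ σ) ∸ 1) (h₂ : beg (u₁ σ) ∸ 1 ≤ n)
     (h₃ : 1 ≤ beg (u₂ σ) ∸ 1) (h₄ : beg (u₂ σ) ∸ 1 ≤ n) →
     letter w (beg (u₁ σ) ∸ 1) h₁ h₂ ≢ letter w (beg (u₂ σ) ∸ 1) h₃ h₄)
  ×
  (end (u₂ σ) < n →
     (h₁ : 1 ≤ suc (end (u₁ σ))) (h₂ : suc (end (u₁ σ)) ≤ n)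
     (h₃ : 1 ≤ suc (end (u₂ σ))) (h₄ : suc (end (u₂ σ)) ≤ n) →
     letter w (suc (end (u₁ σ))) h₁ h₂ ≢ letter w (suc (end (u₂ σ))) h₃ h₄)

Gapped : {A : Set} {n : ℕ} {w : Vec A n} → Repeat w → Set
Gapped σ = suc (end (u₁ σ)) < beg (u₂ σ)

CoveredBy : {A : Set} {n : ℕ} {w : Vec A n} → Repeat w → Repeat w → Set
CoveredBy σ σ' =
  (factBeg σ' ≤ factBeg σ × factEnd σ ≤ factEnd σ') × period σ' < period σ

-- The span end(u'') − beg(u') of a repeat is its period plus |u''| − 1, so it is
-- at least the period; for a gapped repeat |u'| < period, so it is below twice
-- the period. Containment of fact(σ) in fact(σ') gives
-- p(σ) ≤ span σ ≤ span σ' < 2 p(σ').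
module Submission where

open import Defs
open import Data.Nat using (ℕ; _≤_; _<_; _*_; _+_; _∸_; suc)
open import Data.Nat.Properties
open import Data.Vec using (Vec)
open import Data.Product using (_×_; _,_; proj₁)
open import Relation.Binary.PropositionalEquality

∸-split : ∀ {m n o} → m ≤ n → n ≤ o → o ∸ m ≡ (o ∸ n) + (n ∸ m)
∸-split {m} {n} {o} m≤n n≤o = begin
  o ∸ m             ≡⟨ cong (_∸ m) (sym (m∸n+n≡m n≤o)) ⟩
  (o ∸ n) + n ∸ m   ≡⟨ +-∸-assoc (o ∸ n) m≤n ⟩
  (o ∸ n) + (n ∸ m) ∎
  where open ≡-Reasoning

module _ {A : Set} {n : ℕ} {w : Vec A n} where

  span : Repeat w → ℕ
  span σ = factEnd σ ∸ factBeg σ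

  len≡suc[end∸beg] : (u : Factor n) → len u ≡ suc (end u ∸ beg u)
  len≡suc[end∸beg] u = +-∸-assoc 1 (beg≤end u)

  end∸beg-equal : (σ : Repeat w) → end (u₂ σ) ∸ beg (u₂ σ) ≡ end (u₁ σ) ∸ beg (u₁ σ)
  end∸beg-equal σ = suc-injective (begin
    suc (end (u₂ σ) ∸ beg (u₂ σ)) ≡⟨ sym (len≡suc[end∸beg] (u₂ σ)) ⟩
    len (u₂ σ)                    ≡⟨ sym (proj₁ (equal σ)) ⟩
    len (u₁ σ)                    ≡⟨ len≡suc[end∸beg] (u₁ σ) ⟩
    suc (end (u₁ σ) ∸ beg (u₁ σ)) ∎)
    where open ≡-Reasoning

  span≡end∸beg+period : (σ : Repeat w) →
    span σ ≡ (end (u₁ σ) ∸ beg (u₁ σ)) + period σ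
  span≡end∸beg+period σ = begin
    span σ                                  ≡⟨ ∸-split (<⇒≤ (order σ)) (beg≤end (u₂ σ)) ⟩
    (end (u₂ σ) ∸ beg (u₂ σ)) + period σ    ≡⟨ cong (_+ period σ) (end∸beg-equal σ) ⟩
    (end (u₁ σ) ∸ beg (u₁ σ)) + period σ    ∎
    where open ≡-Reasoning

  period≤span : (σ : Repeat w) → period σ ≤ span σ
  period≤span σ = ≤-trans (m≤n+m (period σ) _) (≤-reflexive (sym (span≡end∸beg+period σ)))

  end∸beg<period : (σ : Repeat w) → Gapped σ → end (u₁ σ) ∸ beg (u₁ σ) < period σ
  end∸beg<period σ gapped = ∸-monoˡ-< (<-trans (n<1+n _) gapped) (beg≤end (u₁ σ))

  span<2*period : (σ : Repeat w) → Gapped σ → span σ < 2 * period σ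
  span<2*period σ gapped = begin-strict
    span σ                                  ≡⟨ span≡end∸beg+period σ ⟩
    (end (u₁ σ) ∸ beg (u₁ σ)) + period σ    <⟨ +-monoˡ-< (period σ) (end∸beg<period σ gapped) ⟩
    period σ + period σ                     ≡⟨ cong (period σ +_) (sym (+-identityʳ (period σ))) ⟩
    2 * period σ                            ∎
    where open ≤-Reasoning

proposition21 : {A : Set} {n : ℕ} (w : Vec A n) (σ σ' : Repeat w) →
    Maximal σ → Gapped σ → Maximal σ' → Gapped σ' → CoveredBy σ σ' →
    period σ' ≤ period σ × period σ < 2 * period σ'
proposition21 w σ σ' _ _ _ gapped' ((begs , ends) , p'<p) = <⇒≤ p'<p , p<2p'
  where
  open ≤-Reasoning
  p<2p' : period σ < 2 * period σ'
  p<2p' = begin-strict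
    period σ      ≤⟨ period≤span σ ⟩
    span σ        ≤⟨ ∸-mono ends begs ⟩
    span σ'       <⟨ span<2*period σ' gapped' ⟩
    2 * period σ' ∎
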